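{- There is an integer $N$ such that, for every $\nu\ge N$, there are only finitely many numerical semigroups $S$, with minimal generators $a_1<a_2<\cdots<a_\nu$, such that $a_2>\frac{c(S)+\mu(S)}{3}$, $\nu(S)=\nu$, $\mu(S)\le\frac49\nu^2$, and $S$ does not satisfy Wilf's conjecture (i.e. $\nu(S)|L(S)|<c(S)$).
   Context: A numerical semigroup is a subset $S\subseteq\mathbb{N}$ containing $0$, closed under addition, with $\mathbb{N}\setminus S$ finite. Its conductor $c(S)$ is the least integer $x$ with $x+\mathbb{N}\subseteq S$. $S$ has a unique minimal set of generators; its cardinality is the embedding dimension $\nu(S)$ and its least element is the multiplicity $\mu(S)$. $L(S)=\{x\in S\mid 0\le x<c(S)\}$. $S$ satisfies Wilf's conjecture if $\nu(S)|L(S)|\ge c(S)$. -}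

module Defs where

open import Data.Nat using (ℕ; zero; suc; _+_; _*_; _≤_; _<_; _≡ᵇ_)
open import Data.Bool using (Bool; true; false; not)
open import Data.List using (List; []; _∷_; length; filterᵇ; upTo)
open import Data.List.Membership.Propositional using (_∈_)
open import Data.List.Relation.Unary.Linked using (Linked)
open import Data.Product using (Σ; ∃; _×_; _,_)
open import Relation.Binary.PropositionalEquality using (_≡_)
open import Relation.Nullary using (¬_)

Subset : Set
Subset = ℕ → Bool

_∈S_ : ℕ → Subset → Set
x ∈S S = S x ≡ true

record IsNumericalSemigroup (S : Subset) : Set where
  field
    zero∈ : 0 ∈S S
    closed : ∀ a b → a ∈S S → b ∈S S → (a + b) ∈S S
    cofinite : ∃ λ k → ∀ x → k ≤ x → x ∈S S

IsConductor : Subset → ℕ → Set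
IsConductor S c =
  (∀ x → c ≤ x → x ∈S S) × (∀ d → (∀ x → d ≤ x → x ∈S S) → c ≤ d)

IsMultiplicity : Subset → ℕ → Set
IsMultiplicity S m = (0 < m) × m ∈S S × (∀ x → 0 < x → x ∈S S → m ≤ x)

data Rep (gs : List ℕ) : ℕ → Set where
  rep0 : Rep gs 0
  repStep : ∀ {x g} → g ∈ gs → Rep gs x → Rep gs (g + x)

remove : ℕ → List ℕ → List ℕ
remove g = filterᵇ (λ h → not (h ≡ᵇ g))

IsMinimalGenerators : Subset → List ℕ → Set
IsMinimalGenerators S gs =
  Linked _<_ gs ×
  (∀ x → x ∈S S → Rep gs x) ×
  (∀ x → Rep gs x → x ∈S S) ×
  (∀ g → g ∈ gs → ¬ Rep (remove g gs) g)

sizeL : Subset → ℕ → ℕ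
sizeL S c = length (filterᵇ S (upTo c))

module Submission where

open import Defs
open import Data.Nat using (ℕ; _+_; _*_; _≤_; _<_)
open import Data.List using (List; _∷_; length)
open import Data.List.Relation.Unary.Any using (Any)
open import Data.Product using (∃; ∃-syntax)
open import Relation.Binary.PropositionalEquality using (_≡_)

-- Proposition 4.8 holds with N = 0.  Let S have minimal generators
-- m = a₁ < a₂ < ⋯ < a_ν, conductor c, c + m < 3a₂ and 9m ≤ 4ν²; put
-- G = {a₂, …, a_ν} and t(x) = c − x.  We prove Wilf's inequality once
-- c ≥ B(ν) = 3M² + 3M + 3 (M = 4ν²), so a violator is determined by its
-- values on [0, B(ν)) and lies among 2^B(ν) explicit subsets.  Wilf:
--  (A) the progressions b, b + m, … below c (b ∈ {0} ∪ G) are disjoint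
--      in L(S), so c + Σ_G t ≤ m·|L(S)|; this settles m ≤ ν;
--  (B) as 3a₂ > c + m, the Apéry elements of m below c + m are 0, the
--      g ∈ G and sums u + v of "small pairs" u ≤ v, u + v < c + m; the
--      m residues give m ≤ ν + P with P the number of small pairs;
--  (C) small pairs have t(u) + t(v) + m ≥ c + 1 and each g ∈ G lies in
--      at most ν of them, whence (m − ν)·c ≤ ν·Σ_G t, and with (A) Wilf.
-- The file develops finite sums over lists, counting with duplicate-free
-- lists, the arithmetic, steps (A)–(C), prefixes, and then the result.

open import Data.Nat using (zero; suc; z≤n; s≤s; _∸_; _≤?_; _<?_; _≤ᵇ_; _<ᵇ_; _≡ᵇ_; NonZero; >-nonZero)
open import Data.Nat.Properties
open import Data.Nat.Tactic.RingSolver using (solve-∀)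
open import Data.Bool using (Bool; true; false; T; not; _∧_; if_then_else_)
import Data.Bool as Bool
open import Data.Unit using (tt)
open import Data.Empty using (⊥; ⊥-elim)
open import Data.Fin using (Fin; toℕ)
open import Data.Fin.Properties using (injective⇒≤; toℕ<n; toℕ-injective)
open import Data.List using ([]; _++_; map; concatMap; filterᵇ; upTo; lookup)
open import Data.List.Properties using (length-++; length-map)
open import Data.List.Membership.Propositional using (_∈_; find)
open import Data.List.Membership.Propositional.Properties
  using (∈-lookup; ∈-filter⁺; ∈-filter⁻; ∈-upTo⁺; ∈-map⁺; ∈-map⁻; ∈-++⁺ˡ; ∈-++⁺ʳ; ∈-concatMap⁺; ∈-concatMap⁻)
open import Data.List.Relation.Unary.Any using (here; there; index)
import Data.List.Relation.Unary.Any as Any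
open import Data.List.Relation.Unary.Any.Properties using (lookup-index; map⁺)
open import Data.List.Relation.Unary.All using (All; all?)
import Data.List.Relation.Unary.All as All
open import Data.List.Relation.Unary.All.Properties using (¬All⇒Any¬)
open import Data.List.Relation.Unary.AllPairs using ([]; _∷_)
import Data.List.Relation.Unary.AllPairs as AllPairs
open import Data.List.Relation.Unary.Unique.Propositional using (Unique)
import Data.List.Relation.Unary.Unique.Propositional.Properties as Unique
open import Data.List.Relation.Unary.Linked using (Linked; _∷_)
open import Data.List.Relation.Unary.Linked.Properties using (Linked⇒All; Linked⇒AllPairs)
open import Data.Product using (Σ; _×_; _,_; proj₁; proj₂)
open import Data.Sum using (inj₁; inj₂)
open import Relation.Binary.PropositionalEquality using (refl; sym; trans; cong; cong₂; subst; _≢_; module ≡-Reasoning)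
open import Relation.Binary.Definitions using (tri<; tri≈; tri>)
open import Relation.Nullary using (¬_; yes; no)


module FiniteSums where

  sumL : {A : Set} → List A → (A → ℕ) → ℕ
  sumL [] f = 0
  sumL (x ∷ xs) f = f x + sumL xs f

  module _ {A : Set} where

    sumL-++ : ∀ (xs ys : List A) f → sumL (xs ++ ys) f ≡ sumL xs f + sumL ys f
    sumL-++ [] ys f = refl
    sumL-++ (x ∷ xs) ys f = trans (cong (f x +_) (sumL-++ xs ys f)) (sym (+-assoc (f x) _ _))

    sumL-cong : ∀ (xs : List A) {f g} → (∀ x → x ∈ xs → f x ≡ g x) → sumL xs f ≡ sumL xs g
    sumL-cong [] h = refl
    sumL-cong (x ∷ xs) h = cong₂ _+_ (h x (here refl)) (sumL-cong xs (λ y y∈ → h y (there y∈)))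

    sumL-mono : ∀ (xs : List A) {f g} → (∀ x → x ∈ xs → f x ≤ g x) → sumL xs f ≤ sumL xs g
    sumL-mono [] h = z≤n
    sumL-mono (x ∷ xs) h = +-mono-≤ (h x (here refl)) (sumL-mono xs (λ y y∈ → h y (there y∈)))

    sumL-mono-slack : ∀ (xs : List A) {f g} k y → y ∈ xs → (∀ x → x ∈ xs → f x ≤ g x) →
                      f y + k ≤ g y → sumL xs f + k ≤ sumL xs g
    sumL-mono-slack (x ∷ xs) {f} {g} k y (here refl) h hy = begin
        f y + sumL xs f + k   ≡⟨ +-assoc (f y) _ k ⟩
        f y + (sumL xs f + k) ≡⟨ cong (f y +_) (+-comm (sumL xs f) k) ⟩
        f y + (k + sumL xs f) ≡⟨ sym (+-assoc (f y) k _) ⟩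
        f y + k + sumL xs f   ≤⟨ +-mono-≤ hy (sumL-mono xs (λ z z∈ → h z (there z∈))) ⟩
        g y + sumL xs g       ∎
      where open ≤-Reasoning
    sumL-mono-slack (x ∷ xs) {f} {g} k y (there y∈) h hy = begin
        f x + sumL xs f + k   ≡⟨ +-assoc (f x) _ k ⟩
        f x + (sumL xs f + k) ≤⟨ +-mono-≤ (h x (here refl)) (sumL-mono-slack xs k y y∈ (λ z z∈ → h z (there z∈)) hy) ⟩
        g x + sumL xs g       ∎
      where open ≤-Reasoning

    sumL-+ : ∀ (xs : List A) f g → sumL xs (λ x → f x + g x) ≡ sumL xs f + sumL xs g
    sumL-+ [] f g = refl
    sumL-+ (x ∷ xs) f g = trans (cong (f x + g x +_) (sumL-+ xs f g)) (swap (f x) (g x) _ _)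
      where
      swap : ∀ a b c d → (a + b) + (c + d) ≡ (a + c) + (b + d)
      swap = solve-∀

    sumL-*ˡ : ∀ (xs : List A) k f → sumL xs (λ x → k * f x) ≡ k * sumL xs f
    sumL-*ˡ [] k f = sym (*-zeroʳ k)
    sumL-*ˡ (x ∷ xs) k f = trans (cong (k * f x +_) (sumL-*ˡ xs k f)) (sym (*-distribˡ-+ k (f x) _))

    sumL-*ʳ : ∀ (xs : List A) k f → sumL xs (λ x → f x * k) ≡ sumL xs f * k
    sumL-*ʳ [] k f = refl
    sumL-*ʳ (x ∷ xs) k f = trans (cong (f x * k +_) (sumL-*ʳ xs k f)) (sym (*-distribʳ-+ k (f x) _))

    sumL-const : ∀ (xs : List A) k → sumL xs (λ _ → k) ≡ length xs * k
    sumL-const [] k = refl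
    sumL-const (x ∷ xs) k = cong (k +_) (sumL-const xs k)

    sumL-lower : ∀ (xs : List A) k f → (∀ x → x ∈ xs → k ≤ f x) → length xs * k ≤ sumL xs f
    sumL-lower xs k f h = subst (_≤ sumL xs f) (sumL-const xs k) (sumL-mono xs h)

    sumL-filter : ∀ (xs : List A) p f → sumL (filterᵇ p xs) f ≡ sumL xs (λ x → if p x then f x else 0)
    sumL-filter [] p f = refl
    sumL-filter (x ∷ xs) p f with p x
    ... | true = cong (f x +_) (sumL-filter xs p f)
    ... | false = sumL-filter xs p f

    sumL-zero : ∀ (xs : List A) → sumL xs (λ _ → 0) ≡ 0
    sumL-zero [] = refl
    sumL-zero (_ ∷ xs) = sumL-zero xs

    length≡sumL-1 : ∀ (xs : List A) → length xs ≡ sumL xs (λ _ → 1)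
    length≡sumL-1 xs = trans (sym (*-identityʳ (length xs))) (sym (sumL-const xs 1))

  module _ {A B : Set} where

    sumL-swap : ∀ (xs : List A) (ys : List B) (h : A → B → ℕ) →
       sumL xs (λ x → sumL ys (h x)) ≡ sumL ys (λ y → sumL xs (λ x → h x y))
    sumL-swap [] ys h = sym (sumL-zero ys)
    sumL-swap (x ∷ xs) ys h =
      trans (cong (sumL ys (h x) +_) (sumL-swap xs ys h))
            (sym (sumL-+ ys (h x) (λ y → sumL xs (λ x' → h x' y))))

  sumL-symmetrize : ∀ {A : Set} (xs : List A) (r : A → A → ℕ) (f : A → ℕ) →
    sumL xs (λ x → sumL xs (λ y → r x y * f x + r x y * f y)) ≡ sumL xs (λ x → f x * sumL xs (λ y → r x y + r y x))
  sumL-symmetrize xs r f = begin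
      sumL xs (λ x → sumL xs (λ y → r x y * f x + r x y * f y))
        ≡⟨ sumL-cong xs (λ x _ → sumL-+ xs (λ y → r x y * f x) (λ y → r x y * f y)) ⟩
      sumL xs (λ x → sumL xs (λ y → r x y * f x) + sumL xs (λ y → r x y * f y))
        ≡⟨ sumL-+ xs (λ x → sumL xs (λ y → r x y * f x)) (λ x → sumL xs (λ y → r x y * f y)) ⟩
      sumL xs (λ x → sumL xs (λ y → r x y * f x)) + sumL xs (λ x → sumL xs (λ y → r x y * f y))
        ≡⟨ cong (sumL xs (λ x → sumL xs (λ y → r x y * f x)) +_) (sumL-swap xs xs (λ x y → r x y * f y)) ⟩
      sumL xs (λ x → sumL xs (λ y → r x y * f x)) + sumL xs (λ x → sumL xs (λ y → r y x * f x))
        ≡⟨ sym (sumL-+ xs (λ x → sumL xs (λ y → r x y * f x)) (λ x → sumL xs (λ y → r y x * f x))) ⟩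
      sumL xs (λ x → sumL xs (λ y → r x y * f x) + sumL xs (λ y → r y x * f x))
        ≡⟨ sumL-cong xs (λ x _ → factor x) ⟩
      sumL xs (λ x → f x * sumL xs (λ y → r x y + r y x)) ∎
    where
    open ≡-Reasoning
    factor : ∀ x → sumL xs (λ y → r x y * f x) + sumL xs (λ y → r y x * f x) ≡ f x * sumL xs (λ y → r x y + r y x)
    factor x = begin
      sumL xs (λ y → r x y * f x) + sumL xs (λ y → r y x * f x)
        ≡⟨ cong₂ _+_ (sumL-*ʳ xs (f x) (λ y → r x y)) (sumL-*ʳ xs (f x) (λ y → r y x)) ⟩
      sumL xs (λ y → r x y) * f x + sumL xs (λ y → r y x) * f x
        ≡⟨ sym (*-distribʳ-+ (f x) (sumL xs (λ y → r x y)) _) ⟩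
      (sumL xs (λ y → r x y) + sumL xs (λ y → r y x)) * f x
        ≡⟨ cong (λ s → s * f x) (sym (sumL-+ xs (λ y → r x y) (λ y → r y x))) ⟩
      sumL xs (λ y → r x y + r y x) * f x
        ≡⟨ *-comm (sumL xs (λ y → r x y + r y x)) (f x) ⟩
      f x * sumL xs (λ y → r x y + r y x) ∎

  module _ {A B : Set} where

    sumL-map : ∀ (xs : List A) (g : A → B) f → sumL (map g xs) f ≡ sumL xs (λ x → f (g x))
    sumL-map [] g f = refl
    sumL-map (x ∷ xs) g f = cong (f (g x) +_) (sumL-map xs g f)

    sumL-concatMap : ∀ (xs : List A) (g : A → List B) f → sumL (concatMap g xs) f ≡ sumL xs (λ x → sumL (g x) f)
    sumL-concatMap [] g f = refl
    sumL-concatMap (x ∷ xs) g f = trans (sumL-++ (g x) _ f) (cong (sumL (g x) f +_) (sumL-concatMap xs g f))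

open FiniteSums

module Counting {A : Set} where

  injection-length : ∀ {n} (xs : List A) (f : Fin n → A) → (∀ i → f i ∈ xs) →
                     (∀ i j → f i ≡ f j → i ≡ j) → n ≤ length xs
  injection-length xs f mem inj = injective⇒≤ {f = λ i → index (mem i)} (λ {i} {j} eq →
     inj i j (trans (lookup-index (mem i)) (trans (cong (lookup xs) eq) (sym (lookup-index (mem j))))))

  unique-lookup-injective : ∀ {ys : List A} → Unique ys → ∀ i j → lookup ys i ≡ lookup ys j → i ≡ j
  unique-lookup-injective (_ ∷ _) Fin.zero Fin.zero eq = refl
  unique-lookup-injective {y ∷ ys} (y∉ ∷ _) Fin.zero (Fin.suc j) eq = ⊥-elim (All.lookup y∉ (∈-lookup {xs = ys} j) eq)
  unique-lookup-injective {y ∷ ys} (y∉ ∷ _) (Fin.suc i) Fin.zero eq = ⊥-elim (All.lookup y∉ (∈-lookup {xs = ys} i) (sym eq))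
  unique-lookup-injective (_ ∷ u) (Fin.suc i) (Fin.suc j) eq = cong Fin.suc (unique-lookup-injective u i j eq)

  unique-length : ∀ {ys : List A} (xs : List A) → Unique ys → (∀ {x} → x ∈ ys → x ∈ xs) → length ys ≤ length xs
  unique-length {ys} xs u sub = injection-length xs (lookup ys) (λ i → sub (∈-lookup i)) (unique-lookup-injective u)

  nonempty-member : (xs : List A) → 1 ≤ length xs → ∃ λ x → x ∈ xs
  nonempty-member (x ∷ xs) _ = x , here refl

  concatMap-unique : ∀ {bs : List A} (P : A → List A) → Unique bs → (∀ b → Unique (P b)) →
     (∀ b b' x → b ∈ bs → b' ∈ bs → x ∈ P b → x ∈ P b' → b ≡ b') → Unique (concatMap P bs)
  concatMap-unique {[]} P u uP disj = []
  concatMap-unique {b ∷ bs} P (b∉ ∷ u) uP disj =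
    Unique.++⁺ (uP b) (concatMap-unique P u uP (λ b₁ b₂ x b₁∈ b₂∈ → disj b₁ b₂ x (there b₁∈) (there b₂∈)))
      (λ { (x∈ , x∈') → let (b' , b'∈ , x∈b') = find (∈-concatMap⁻ P {xs = bs} x∈') in
             All.lookup b∉ b'∈ (disj b b' _ (here refl) (there b'∈) x∈ x∈b') })

open Counting

module Arithmetic where

  wilf-from-excess : ∀ ν m c T L e → m ≡ ν + e → c + T ≤ m * L → e * c ≤ ν * T →
                     .{{_ : NonZero m}} → c ≤ ν * L
  wilf-from-excess ν m c T L e m≡ν+e hA he = *-cancelˡ-≤ m (begin
      m * c             ≡⟨ cong (_* c) m≡ν+e ⟩
      (ν + e) * c       ≡⟨ *-distribʳ-+ c ν e ⟩
      ν * c + e * c     ≤⟨ +-monoʳ-≤ (ν * c) he ⟩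
      ν * c + ν * T     ≡⟨ sym (*-distribˡ-+ ν c T) ⟩
      ν * (c + T)       ≤⟨ *-monoʳ-≤ ν hA ⟩
      ν * (m * L)       ≡⟨ swap ν m L ⟩
      m * (ν * L)       ∎)
    where
    open ≤-Reasoning
    swap : ∀ a b d → a * (b * d) ≡ b * (a * d)
    swap = solve-∀

  -- Excess bound when the K = ν − 1 "diagonal" pairs (g, g) all satisfy
  -- the pair inequality c + 1 ≤ 2·t(g) + m.
  excess-bound-diagonal : ∀ K m c T e → K * (c + 1) ≤ 2 * T + K * m → 2 * e + 1 ≤ suc K * K →
                          suc K * K * m ≤ c → e * c ≤ suc K * T
  excess-bound-diagonal K m c T e hK he hc = *-cancelˡ-≤ 2 (+-cancelʳ-≤ (c + n) (2 * (e * c)) (2 * (suc K * T)) (begin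
      2 * (e * c) + (c + n)        ≡⟨ eq₁ e c n ⟩
      (2 * e + 1) * c + n          ≤⟨ +-monoˡ-≤ n (*-monoˡ-≤ c he) ⟩
      n * c + n                    ≡⟨ eq₂ K c ⟩
      suc K * (K * (c + 1))        ≤⟨ *-monoʳ-≤ (suc K) hK ⟩
      suc K * (2 * T + K * m)      ≡⟨ eq₃ K T m ⟩
      2 * (suc K * T) + n * m      ≤⟨ +-monoʳ-≤ (2 * (suc K * T)) hc ⟩
      2 * (suc K * T) + c          ≤⟨ +-monoʳ-≤ (2 * (suc K * T)) (m≤m+n c n) ⟩
      2 * (suc K * T) + (c + n)    ∎))
    where
    open ≤-Reasoning
    n = suc K * K
    eq₁ : ∀ e c n → 2 * (e * c) + (c + n) ≡ (2 * e + 1) * c + n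
    eq₁ = solve-∀
    eq₂ : ∀ K c → suc K * K * c + suc K * K ≡ suc K * (K * (c + 1))
    eq₂ = solve-∀
    eq₃ : ∀ K T m → suc K * (2 * T + K * m) ≡ 2 * (suc K * T) + suc K * K * m
    eq₃ = solve-∀

  -- Excess bound from P ≥ e small pairs of total weight W, when some
  -- gap t_z with c + 3 ≤ 3·t_z + 2m is left over: W + t_z ≤ ν·T.
  excess-bound-pairs : ∀ ν m c T P W tz e →
    P * (c + 1) ≤ W + P * m → W + tz ≤ T * ν → c + 3 ≤ 3 * tz + 2 * m → e ≤ P → m ≤ c + 1 →
    3 * (e * m) + 2 * m ≤ c → e * c ≤ ν * T
  excess-bound-pairs ν m c T P W tz e hP hW htz e≤P m≤c+1 hc =
    +-cancelʳ-≤ (e + (e * m + 1)) (e * c) (ν * T) (begin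
      e * c + (e + (e * m + 1)) ≡⟨ eq₁ e c (e * m + 1) ⟩
      e * (c + 1) + (e * m + 1) ≤⟨ +-monoʳ-≤ (e * (c + 1)) em<tz ⟩
      e * (c + 1) + tz          ≤⟨ +-monoˡ-≤ tz e-pairs ⟩
      W + e * m + tz            ≡⟨ eq₂ W (e * m) tz ⟩
      W + tz + e * m            ≤⟨ +-monoˡ-≤ (e * m) hW ⟩
      T * ν + e * m             ≡⟨ cong (_+ e * m) (*-comm T ν) ⟩
      ν * T + e * m             ≤⟨ +-monoʳ-≤ (ν * T) (m≤m+n (e * m) 1) ⟩
      ν * T + (e * m + 1)       ≤⟨ +-monoʳ-≤ (ν * T) (m≤n+m (e * m + 1) e) ⟩
      ν * T + (e + (e * m + 1)) ∎)
    where
    open ≤-Reasoning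
    p = P ∸ e
    P≡e+p : P ≡ e + p
    P≡e+p = sym (m+[n∸m]≡n e≤P)
    eq₁ : ∀ e c x → e * c + (e + x) ≡ e * (c + 1) + x
    eq₁ = solve-∀
    eq₂ : ∀ a b d → a + b + d ≡ a + d + b
    eq₂ = solve-∀
    eq₃ : ∀ e p c → (e + p) * c ≡ e * c + p * c
    eq₃ = solve-∀
    eq₄ : ∀ W e p m → W + (e + p) * m ≡ W + e * m + p * m
    eq₄ = solve-∀
    eq₅ : ∀ x m → 3 * (x + 1) + 2 * m ≡ 3 * x + 2 * m + 3
    eq₅ = solve-∀
    -- since m ≤ c + 1, the inequality for P pairs restricts to e of them
    e-pairs : e * (c + 1) ≤ W + e * m
    e-pairs = +-cancelʳ-≤ (p * m) (e * (c + 1)) (W + e * m) (begin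
        e * (c + 1) + p * m        ≤⟨ +-monoʳ-≤ (e * (c + 1)) (*-monoʳ-≤ p m≤c+1) ⟩
        e * (c + 1) + p * (c + 1)  ≡⟨ sym (eq₃ e p (c + 1)) ⟩
        (e + p) * (c + 1)          ≡⟨ cong (_* (c + 1)) (sym P≡e+p) ⟩
        P * (c + 1)                ≤⟨ hP ⟩
        W + P * m                  ≡⟨ cong (λ x → W + x * m) P≡e+p ⟩
        W + (e + p) * m            ≡⟨ eq₄ W e p m ⟩
        W + e * m + p * m          ∎)
    em<tz : e * m + 1 ≤ tz
    em<tz = *-cancelˡ-≤ 3 (+-cancelʳ-≤ (2 * m) (3 * (e * m + 1)) (3 * tz) (begin
        3 * (e * m + 1) + 2 * m    ≡⟨ eq₅ (e * m) m ⟩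
        3 * (e * m) + 2 * m + 3    ≤⟨ +-monoˡ-≤ 3 hc ⟩
        c + 3                      ≤⟨ htz ⟩
        3 * tz + 2 * m             ∎))

  excess-quadratic : ∀ K e → 9 * (suc K + e) ≤ 4 * (suc K * suc K) → 2 * e + 1 ≤ suc K * K
  excess-quadratic K e h = *-cancelˡ-≤ 9 (+-cancelʳ-≤ (18 * suc K) (9 * (2 * e + 1)) (9 * (suc K * K)) (begin
      9 * (2 * e + 1) + 18 * suc K                          ≡⟨ eq₁ K e ⟩
      2 * (9 * (suc K + e)) + 9                             ≤⟨ +-monoˡ-≤ 9 (*-monoʳ-≤ 2 h) ⟩
      2 * (4 * (suc K * suc K)) + 9                         ≤⟨ m≤m+n _ (K * K + 11 * K + 1) ⟩
      2 * (4 * (suc K * suc K)) + 9 + (K * K + 11 * K + 1)  ≡⟨ eq₂ K ⟩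
      9 * (suc K * K) + 18 * suc K                          ∎))
    where
    open ≤-Reasoning
    eq₁ : ∀ K e → 9 * (2 * e + 1) + 18 * suc K ≡ 2 * (9 * (suc K + e)) + 9
    eq₁ = solve-∀
    eq₂ : ∀ K → 2 * (4 * (suc K * suc K)) + 9 + (K * K + 11 * K + 1) ≡ 9 * (suc K * K) + 18 * suc K
    eq₂ = solve-∀

  multBound : ℕ → ℕ
  multBound ν = 4 * (ν * ν)

  conductorBound : ℕ → ℕ
  conductorBound ν = 3 * (multBound ν * multBound ν) + 3 * multBound ν + 3

  m≤multBound : ∀ ν m → 9 * m ≤ 4 * (ν * ν) → m ≤ multBound ν
  m≤multBound ν m h = ≤-trans (m≤n*m m 9) h

  module LargeConductor (ν m c : ℕ) (h9 : 9 * m ≤ 4 * (ν * ν)) (hB : conductorBound ν ≤ c) where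

    private
      M = multBound ν
      m≤M = m≤multBound ν m h9

    m≤c+1 : m ≤ c + 1
    m≤c+1 = ≤-trans m≤M (≤-trans (m≤n+m M (3 * (M * M))) (≤-trans (+-monoʳ-≤ (3 * (M * M)) (m≤n*m M 3))
              (≤-trans (m≤m+n _ 3) (≤-trans hB (m≤m+n c 1)))))

    ν[ν-1]m≤c : ∀ K → ν ≡ suc K → suc K * K * m ≤ c
    ν[ν-1]m≤c K refl = ≤-trans (*-mono-≤ ν[ν-1]≤M m≤M) (≤-trans (≤-trans (m≤n*m (M * M) 3) (≤-trans (m≤m+n _ _) (m≤m+n _ _))) hB)
      where
      ν[ν-1]≤M : suc K * K ≤ M
      ν[ν-1]≤M = ≤-trans (*-monoʳ-≤ (suc K) (n≤1+n K)) (m≤n*m (suc K * suc K) 4)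

    3em+2m≤c : ∀ e → e ≤ m → 3 * (e * m) + 2 * m ≤ c
    3em+2m≤c e e≤m = ≤-trans (+-mono-≤ (*-monoʳ-≤ 3 (*-mono-≤ (≤-trans e≤m m≤M) m≤M))
                                       (≤-trans (*-monoʳ-≤ 2 m≤M) (*-monoˡ-≤ M (n≤1+n 2))))
                             (≤-trans (m≤m+n _ 3) hB)

open Arithmetic

module WilfArgument (S : Subset) (ns : IsNumericalSemigroup S) (m a₂ : ℕ) (rest : List ℕ) (c : ℕ)
  (mg : IsMinimalGenerators S (m ∷ a₂ ∷ rest)) (cond : IsConductor S c) (0<m : 0 < m)
  (c+m<3a₂ : c + m < 3 * a₂) where

  G : List ℕ
  G = a₂ ∷ rest

  gens : List ℕ
  gens = m ∷ G

  K : ℕ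
  K = length G

  m<a₂ : m < a₂
  m<a₂ with proj₁ mg
  ... | m<a₂ ∷ _ = m<a₂

  G-increasing : Linked _<_ G
  G-increasing with proj₁ mg
  ... | _ ∷ l = l

  a₂≤ : ∀ {g} → g ∈ G → a₂ ≤ g
  a₂≤ (here refl) = ≤-refl
  a₂≤ (there g∈) with G-increasing
  ... | a₂<g ∷ l = <⇒≤ (All.lookup (Linked⇒All <-trans a₂<g l) g∈)

  m<gen : ∀ {g} → g ∈ G → m < g
  m<gen g∈ = <-≤-trans m<a₂ (a₂≤ g∈)

  rep⇒∈S : ∀ {x} → Rep gens x → x ∈S S
  rep⇒∈S {x} r = proj₁ (proj₂ (proj₂ mg)) x r

  ∈S⇒rep : ∀ {x} → x ∈S S → Rep gens x
  ∈S⇒rep {x} s = proj₁ (proj₂ mg) x s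

  minimal : ∀ {g} → g ∈ gens → ¬ Rep (remove g gens) g
  minimal {g} g∈ = proj₂ (proj₂ (proj₂ mg)) g g∈

  closed : ∀ {a b} → a ∈S S → b ∈S S → (a + b) ∈S S
  closed {a} {b} = IsNumericalSemigroup.closed ns a b

  gen∈S : ∀ {g} → g ∈ gens → g ∈S S
  gen∈S {g} g∈ = rep⇒∈S (subst (Rep gens) (+-identityʳ g) (repStep g∈ rep0))

  m∈S : m ∈S S
  m∈S = gen∈S (here refl)

  0∷G-unique : Unique (0 ∷ G)
  0∷G-unique = AllPairs.map <⇒≢ (Linked⇒AllPairs <-trans (<-≤-trans 0<m (<⇒≤ m<a₂) ∷ G-increasing))

  G-unique : Unique G
  G-unique with 0∷G-unique
  ... | _ ∷ u = u

  ∈remove : ∀ {x g} → x ∈ gens → x ≢ g → x ∈ remove g gens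
  ∈remove {x} {g} x∈ x≢g = ∈-filter⁺ (λ h → Bool.T? (not (h ≡ᵇ g))) x∈ (≢⇒T x g x≢g)
    where
    ≢⇒T : ∀ x g → x ≢ g → T (not (x ≡ᵇ g))
    ≢⇒T x g x≢g with x ≡ᵇ g in eq
    ... | true = ⊥-elim (x≢g (≡ᵇ⇒≡ x g (subst T (sym eq) tt)))
    ... | false = tt

  gap : ℕ → ℕ
  gap x = c ∸ x

  deficit : ℕ
  deficit = sumL G gap

  -- (A) Lower bound for |L(S)|.  For b ∈ {0} ∪ G the progression
  -- b, b + m, b + 2m, … below c lies in L(S); it has at least t(b)/m
  -- terms, and distinct bases give disjoint progressions (a coincidence
  -- b' = b + jm would make the generator b' redundant).

  -- The terms of b, b + m, … below c, using f steps of fuel (f = c suffices).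
  progression : ℕ → ℕ → List ℕ
  progression zero x = []
  progression (suc f) x with x <? c
  ... | yes _ = x ∷ progression f (x + m)
  ... | no _ = []

  progression-elem : ∀ f x y → y ∈ progression f x → y < c × ∃ λ j → y ≡ x + j * m
  progression-elem (suc f) x y y∈ with x <? c
  progression-elem (suc f) x y (here refl) | yes x<c = x<c , 0 , sym (+-identityʳ x)
  progression-elem (suc f) x y (there y∈) | yes x<c with progression-elem f (x + m) y y∈
  ... | y<c , j , eq = y<c , suc j , trans eq (+-assoc x m (j * m))

  progression-unique : ∀ f x → Unique (progression f x)
  progression-unique zero x = []
  progression-unique (suc f) x with x <? c
  ... | yes _ = All.tabulate (λ {y} y∈ → x≢later y y∈) ∷ progression-unique f (x + m)
    where
    x≢later : ∀ y → y ∈ progression f (x + m) → x ≢ y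
    x≢later y y∈ x≡y with progression-elem f (x + m) y y∈
    ... | _ , j , y≡ = <-irrefl x≡y (<-≤-trans (m<m+n x 0<m) (subst (x + m ≤_) (sym y≡) (m≤m+n (x + m) (j * m))))
  ... | no _ = []

  progression-length : ∀ f x → c ∸ x ≤ f → c ∸ x ≤ m * length (progression f x)
  progression-length zero x h = ≤-trans h z≤n
  progression-length (suc f) x h with x <? c
  ... | no x≮c = subst (_≤ m * 0) (sym (m≤n⇒m∸n≡0 (≮⇒≥ x≮c))) z≤n
  ... | yes x<c = begin
      c ∸ x                                   ≤⟨ m≤n+m∸n (c ∸ x) m ⟩
      m + (c ∸ x ∸ m)                         ≡⟨ cong (m +_) (∸-+-assoc c x m) ⟩
      m + (c ∸ (x + m))                       ≤⟨ +-monoʳ-≤ m (progression-length f (x + m) fuel) ⟩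
      m + m * length (progression f (x + m))  ≡⟨ sym (*-suc m _) ⟩
      m * suc (length (progression f (x + m))) ∎
    where
    open ≤-Reasoning
    fuel : c ∸ (x + m) ≤ f
    fuel = begin
      c ∸ (x + m)  ≡⟨ sym (∸-+-assoc c x m) ⟩
      c ∸ x ∸ m    ≤⟨ ∸-monoʳ-≤ (c ∸ x) 0<m ⟩
      c ∸ x ∸ 1    ≤⟨ ∸-monoˡ-≤ 1 h ⟩
      f            ∎

  rep-add-multiple : ∀ {zs} k {x} → m ∈ zs → Rep zs x → Rep zs (k * m + x)
  rep-add-multiple zero m∈ r = r
  rep-add-multiple {zs} (suc k) {x} m∈ r =
    subst (Rep zs) (sym (+-assoc m (k * m) x)) (repStep m∈ (rep-add-multiple k m∈ r))

  ∈S-add-multiple : ∀ k {x} → x ∈S S → (x + k * m) ∈S S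
  ∈S-add-multiple zero {x} s = subst (_∈S S) (sym (+-identityʳ x)) s
  ∈S-add-multiple (suc k) {x} s = subst (_∈S S) (+-assoc x m (k * m)) (∈S-add-multiple k (closed s m∈S))

  bases : List ℕ
  bases = 0 ∷ G

  base∈S : ∀ {b} → b ∈ bases → b ∈S S
  base∈S (here refl) = IsNumericalSemigroup.zero∈ ns
  base∈S (there b∈) = gen∈S (there b∈)

  shift-difference : ∀ b b' j j' → b < b' → b + j * m ≡ b' + j' * m → b' ≡ (j ∸ j') * m + b
  shift-difference b b' j j' b<b' eq with j' ≤? j
  ... | no j'≰j = ⊥-elim (<-irrefl eq (<-≤-trans (+-monoˡ-< (j * m) b<b') (+-monoʳ-≤ b' (*-monoˡ-≤ m (<⇒≤ (≰⇒> j'≰j))))))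
  ... | yes j'≤j = +-cancelʳ-≡ (j' * m) b' ((j ∸ j') * m + b) (begin
       b' + j' * m                 ≡⟨ sym eq ⟩
       b + j * m                   ≡⟨ cong (λ z → b + z * m) (sym (m∸n+n≡m j'≤j)) ⟩
       b + (j ∸ j' + j') * m       ≡⟨ cong (b +_) (*-distribʳ-+ m (j ∸ j') j') ⟩
       b + ((j ∸ j') * m + j' * m) ≡⟨ sym (+-assoc b _ _) ⟩
       b + (j ∸ j') * m + j' * m   ≡⟨ cong (_+ j' * m) (+-comm b _) ⟩
       (j ∸ j') * m + b + j' * m   ∎)
    where open ≡-Reasoning

  -- A smaller base b is generated without b', so b' = (j − j')m + b would
  -- contradict the minimality of the generator b'.
  bases-no-collision : ∀ {b b'} j j' → b ∈ bases → b' ∈ bases → b < b' → b + j * m ≢ b' + j' * m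
  bases-no-collision j j' b∈ (here refl) () eq
  bases-no-collision {b} {b'} j j' b∈ (there b'∈) b<b' eq =
    minimal (there b'∈) (subst (Rep (remove b' gens)) (sym (shift-difference b b' j j' b<b' eq))
                               (rep-add-multiple (j ∸ j') m∈ (smaller-base b∈ b<b')))
    where
    m∈ : m ∈ remove b' gens
    m∈ = ∈remove (here refl) (<⇒≢ (m<gen b'∈))
    smaller-base : ∀ {z} → z ∈ bases → z < b' → Rep (remove b' gens) z
    smaller-base (here refl) _ = rep0
    smaller-base {z} (there z∈G) z<b' =
      subst (Rep (remove b' gens)) (+-identityʳ z) (repStep (∈remove (there z∈G) (<⇒≢ z<b')) rep0)

  progressions-disjoint : ∀ b b' y → b ∈ bases → b' ∈ bases →
                          y ∈ progression c b → y ∈ progression c b' → b ≡ b'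
  progressions-disjoint b b' y b∈ b'∈ y∈ y∈' with progression-elem c b y y∈ | progression-elem c b' y y∈'
  ... | _ , j , eq | _ , j' , eq' with <-cmp b b'
  ... | tri< b<b' _ _ = ⊥-elim (bases-no-collision j j' b∈ b'∈ b<b' (trans (sym eq) eq'))
  ... | tri≈ _ b≡b' _ = b≡b'
  ... | tri> _ _ b>b' = ⊥-elim (bases-no-collision j' j b'∈ b∈ b>b' (trans (sym eq') eq))

  progression-terms : List ℕ
  progression-terms = concatMap (progression c) bases

  progression-terms⊆L : ∀ {y} → y ∈ progression-terms → y ∈ filterᵇ S (upTo c)
  progression-terms⊆L {y} y∈ with find (∈-concatMap⁻ (progression c) {xs = bases} y∈)
  ... | b , b∈ , y∈b with progression-elem c b y y∈b
  ... | y<c , j , refl = ∈-filter⁺ (λ x → Bool.T? (S x)) (∈-upTo⁺ y<c) (subst T (sym (∈S-add-multiple j (base∈S b∈))) tt)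

  L-lower-bound : c + deficit ≤ m * sizeL S c
  L-lower-bound = begin
      c + deficit                                      ≤⟨ sumL-mono bases (λ b _ → progression-length c b (m∸n≤m c b)) ⟩
      sumL bases (λ b → m * length (progression c b))  ≡⟨ sumL-*ˡ bases m _ ⟩
      m * sumL bases (λ b → length (progression c b))  ≡⟨ cong (m *_) (sym #terms) ⟩
      m * length progression-terms                     ≤⟨ *-monoʳ-≤ m (unique-length (filterᵇ S (upTo c)) terms-unique progression-terms⊆L) ⟩
      m * sizeL S c                                    ∎
    where
    open ≤-Reasoning
    terms-unique : Unique progression-terms
    terms-unique = concatMap-unique (progression c) 0∷G-unique (progression-unique c) progressions-disjoint
    #terms : length progression-terms ≡ sumL bases (λ b → length (progression c b))
    #terms = trans (length≡sumL-1 progression-terms) (trans (sumL-concatMap bases (progression c) (λ _ → 1))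
              (sumL-cong bases (λ b _ → sym (length≡sumL-1 (progression c b)))))

  -- (B) Counting Apéry elements.  Call w ∈ S an Apéry element if w − m ∉ S.
  -- Because 3a₂ > c + m, an Apéry element below c + m is a sum of at most
  -- two generators from G, so it is coded by 0, some g ∈ G, or a small
  -- pair.  Each y ∈ [c, c + m) descends (by subtracting m) to an Apéry
  -- element, and different y give different ones: hence m ≤ ν + P.

  rotate : ∀ a b d → d + (a + b) ≡ a + (d + b)
  rotate = solve-∀

  apery-descent : ℕ → ℕ → ℕ
  apery-descent zero y = y
  apery-descent (suc f) y with m ≤? y
  ... | no _ = y
  ... | yes _ with S (y ∸ m)
  ...   | true = apery-descent f (y ∸ m)
  ...   | false = y

  apery-descent-∈S : ∀ f y → y ∈S S → apery-descent f y ∈S S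
  apery-descent-∈S zero y s = s
  apery-descent-∈S (suc f) y s with m ≤? y
  ... | no _ = s
  ... | yes _ with S (y ∸ m) in eq
  ...   | true = apery-descent-∈S f (y ∸ m) eq
  ...   | false = s

  apery-descent-shift : ∀ f y → ∃ λ j → y ≡ apery-descent f y + j * m
  apery-descent-shift zero y = 0 , sym (+-identityʳ y)
  apery-descent-shift (suc f) y with m ≤? y
  ... | no _ = 0 , sym (+-identityʳ y)
  ... | yes m≤y with S (y ∸ m)
  ...   | true = let (j , eq) = apery-descent-shift f (y ∸ m) in
                 suc j , trans (sym (m+[n∸m]≡n m≤y)) (trans (cong (m +_) eq) (rotate (apery-descent f (y ∸ m)) (j * m) m))
  ...   | false = 0 , sym (+-identityʳ y)

  IsApery : ℕ → Set
  IsApery w = ¬ (m ≤ w × (w ∸ m) ∈S S)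

  apery-descent-apery : ∀ f y → y ≤ f → IsApery (apery-descent f y)
  apery-descent-apery zero y y≤0 (m≤ , _) = <-irrefl refl (<-≤-trans 0<m (≤-trans m≤ y≤0))
  apery-descent-apery (suc f) y y≤ with m ≤? y
  ... | no m≰y = λ (m≤ , _) → m≰y m≤
  ... | yes m≤y with S (y ∸ m) in eq
  ...   | true = apery-descent-apery f (y ∸ m) (≤-trans (∸-monoʳ-≤ y 0<m) (∸-monoˡ-≤ 1 y≤))
  ...   | false = λ (_ , s) → false≢true (trans (sym eq) s)
    where
    false≢true : false ≢ true
    false≢true ()

  not-apery : ∀ {w} x → w ≡ m + x → x ∈S S → ¬ IsApery w
  not-apery x refl s apery = apery (m≤m+n m x , subst (_∈S S) (sym (m+n∸m≡n m x)) s)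

  smallPair : ℕ → ℕ → Bool
  smallPair x y = (x ≤ᵇ y) ∧ (x + y <ᵇ c + m)

  pairs : List (ℕ × ℕ)
  pairs = concatMap (λ x → map (x ,_) (filterᵇ (smallPair x) G)) G

  P : ℕ
  P = length pairs

  T-∧ : ∀ {a b} → T a → T b → T (a ∧ b)
  T-∧ {true} {true} _ _ = tt

  T-∧⁻ : ∀ {a b} → T (a ∧ b) → T a × T b
  T-∧⁻ {true} {true} _ = tt , tt

  pairs⁺ : ∀ {u v} → u ∈ G → v ∈ G → u ≤ v → u + v < c + m → (u , v) ∈ pairs
  pairs⁺ {u} {v} u∈ v∈ u≤v lt = ∈-concatMap⁺ (λ x → map (x ,_) (filterᵇ (smallPair x) G)) {xs = G}
    (Any.map (λ { refl → ∈-map⁺ (u ,_) (∈-filter⁺ (λ y → Bool.T? (smallPair u y)) v∈ (T-∧ (≤⇒≤ᵇ u≤v) (<⇒<ᵇ lt))) }) u∈)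

  pairs⁻ : ∀ {u v} → (u , v) ∈ pairs → u ∈ G × v ∈ G × u ≤ v × u + v < c + m
  pairs⁻ p∈ with find (∈-concatMap⁻ (λ x → map (x ,_) (filterᵇ (smallPair x) G)) {xs = G} p∈)
  ... | x , x∈ , p∈' with ∈-map⁻ (x ,_) p∈'
  ... | y , y∈ , refl with ∈-filter⁻ (λ z → Bool.T? (smallPair x z)) {xs = G} y∈
  ... | y∈G , small with T-∧⁻ {x ≤ᵇ y} small
  ... | x≤y , x+y<c+m = x∈ , y∈G , ≤ᵇ⇒≤ x y x≤y , <ᵇ⇒< (x + y) (c + m) x+y<c+m

  -- Codes (u, v) of Apéry elements u + v below c + m.
  codes : List (ℕ × ℕ)
  codes = (0 , 0) ∷ (map (λ g → (g , 0)) G ++ pairs)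

  Coded : ℕ → Set
  Coded w = Σ (ℕ × ℕ) λ p → p ∈ codes × proj₁ p + proj₂ p ≡ w

  -- Inspect a representation of w: a summand m contradicts IsApery, and
  -- three summands from G exceed 3a₂ > c + m.
  apery-coded : ∀ w → Rep gens w → w < c + m → IsApery w → Coded w
  apery-coded .0 rep0 _ _ = (0 , 0) , here refl , refl
  apery-coded .(m + x) (repStep {x} (here refl) r) _ ap = ⊥-elim (not-apery x refl (rep⇒∈S r) ap)
  apery-coded .(g + 0) (repStep {_} {g} (there g∈) rep0) _ _ =
    (g , 0) , there (∈-++⁺ˡ (∈-map⁺ (λ h → (h , 0)) g∈)) , refl
  apery-coded .(g + (m + x)) (repStep {_} {g} (there g∈) (repStep {x} (here refl) r)) _ ap =
    ⊥-elim (not-apery (g + x) (sym (rotate g x m)) (rep⇒∈S (repStep (there g∈) r)) ap)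
  apery-coded .(g + (g' + 0)) (repStep {_} {g} (there g∈) (repStep {_} {g'} (there g'∈) rep0)) lt _ with g ≤? g'
  ... | yes g≤g' = (g , g') , there (∈-++⁺ʳ (map (λ h → (h , 0)) G) (pairs⁺ g∈ g'∈ g≤g' small)) , cong (g +_) (sym (+-identityʳ g'))
    where
    small : g + g' < c + m
    small = subst (_< c + m) (cong (g +_) (+-identityʳ g')) lt
  ... | no g≰g' = (g' , g) , there (∈-++⁺ʳ (map (λ h → (h , 0)) G) (pairs⁺ g'∈ g∈ (<⇒≤ (≰⇒> g≰g')) small)) ,
                  trans (+-comm g' g) (cong (g +_) (sym (+-identityʳ g')))
    where
    small : g' + g < c + m
    small = subst (_< c + m) (trans (cong (g +_) (+-identityʳ g')) (+-comm g g')) lt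
  apery-coded .(g + (g' + (m + x))) (repStep {_} {g} (there g∈) (repStep {_} {g'} (there g'∈) (repStep {x} (here refl) r))) _ ap =
    ⊥-elim (not-apery (g + (g' + x)) (trans (cong (g +_) (sym (rotate g' x m))) (sym (rotate g (g' + x) m)))
                      (rep⇒∈S (repStep (there g∈) (repStep (there g'∈) r))) ap)
  apery-coded .(g + (g' + (g'' + x))) (repStep {_} {g} (there g∈) (repStep {_} {g'} (there g'∈) (repStep {x} {g''} (there g''∈) r))) lt _ =
    ⊥-elim (<-irrefl refl (<-≤-trans (<-trans lt c+m<3a₂) three-gens))
    where
    three-gens : 3 * a₂ ≤ g + (g' + (g'' + x))
    three-gens = begin
      3 * a₂                      ≡⟨ triple a₂ ⟩
      a₂ + (a₂ + (a₂ + 0))        ≤⟨ +-mono-≤ (a₂≤ g∈) (+-mono-≤ (a₂≤ g'∈) (+-mono-≤ (a₂≤ g''∈) z≤n)) ⟩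
      g + (g' + (g'' + x))        ∎
      where
      open ≤-Reasoning
      triple : ∀ a → 3 * a ≡ a + (a + (a + 0))
      triple = solve-∀

  leaves-window : ∀ w a b → c ≤ w + a * m → w + b * m < c + m → a < b → ⊥
  leaves-window w a b c≤ lt a<b = <-irrefl refl (<-≤-trans lt (begin
      c + m            ≤⟨ +-monoˡ-≤ m c≤ ⟩
      w + a * m + m    ≡⟨ +-assoc w (a * m) m ⟩
      w + (a * m + m)  ≡⟨ cong (w +_) (+-comm (a * m) m) ⟩
      w + suc a * m    ≤⟨ +-monoʳ-≤ w (*-monoˡ-≤ m a<b) ⟩
      w + b * m        ∎))
    where open ≤-Reasoning

  window-unique : ∀ w j j' → c ≤ w + j * m → w + j * m < c + m → c ≤ w + j' * m → w + j' * m < c + m → j ≡ j'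
  window-unique w j j' c≤ in₁ c≤' in₂ with <-cmp j j'
  ... | tri< j<j' _ _ = ⊥-elim (leaves-window w j j' c≤ in₂ j<j')
  ... | tri≈ _ j≡j' _ = j≡j'
  ... | tri> _ _ j>j' = ⊥-elim (leaves-window w j' j c≤' in₁ j>j')

  module WindowCodes where

    window : Fin m → ℕ
    window i = c + toℕ i

    window< : ∀ i → window i < c + m
    window< i = +-monoʳ-< c (toℕ<n i)

    aperyOf : Fin m → ℕ
    aperyOf i = apery-descent (window i) (window i)

    aperyOf≤ : ∀ i → aperyOf i ≤ window i
    aperyOf≤ i with apery-descent-shift (window i) (window i)
    ... | j , eq = subst (aperyOf i ≤_) (sym eq) (m≤m+n (aperyOf i) (j * m))

    coded : ∀ i → Coded (aperyOf i)
    coded i = apery-coded (aperyOf i)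
      (∈S⇒rep (apery-descent-∈S (window i) (window i) (proj₁ cond (window i) (m≤m+n c (toℕ i)))))
      (≤-<-trans (aperyOf≤ i) (window< i))
      (apery-descent-apery (window i) (window i) ≤-refl)

    code : Fin m → ℕ × ℕ
    code i = proj₁ (coded i)

    -- Equal codes give equal Apéry elements, hence (window-unique) equal points.
    code-injective : ∀ i j → code i ≡ code j → i ≡ j
    code-injective i j eq = toℕ-injective (+-cancelˡ-≡ c (toℕ i) (toℕ j) window-eq)
      where
      shiftᵢ = apery-descent-shift (window i) (window i)
      shiftⱼ = apery-descent-shift (window j) (window j)
      apery-eq : aperyOf i ≡ aperyOf j
      apery-eq = trans (sym (proj₂ (proj₂ (coded i))))
                       (trans (cong (λ p → proj₁ p + proj₂ p) eq) (proj₂ (proj₂ (coded j))))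
      in-windowᵢ : c ≤ aperyOf j + proj₁ shiftᵢ * m
      in-windowᵢ = subst (λ z → c ≤ z + proj₁ shiftᵢ * m) apery-eq (subst (c ≤_) (proj₂ shiftᵢ) (m≤m+n c (toℕ i)))
      belowᵢ : aperyOf j + proj₁ shiftᵢ * m < c + m
      belowᵢ = subst (λ z → z + proj₁ shiftᵢ * m < c + m) apery-eq (subst (_< c + m) (proj₂ shiftᵢ) (window< i))
      shift-eq : proj₁ shiftᵢ ≡ proj₁ shiftⱼ
      shift-eq = window-unique (aperyOf j) (proj₁ shiftᵢ) (proj₁ shiftⱼ) in-windowᵢ belowᵢ
                   (subst (c ≤_) (proj₂ shiftⱼ) (m≤m+n c (toℕ j))) (subst (_< c + m) (proj₂ shiftⱼ) (window< j))
      window-eq : window i ≡ window j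
      window-eq = trans (proj₂ shiftᵢ) (trans (cong₂ (λ u v → u + v * m) apery-eq shift-eq) (sym (proj₂ shiftⱼ)))

  m≤ν+P : m ≤ suc (K + P)
  m≤ν+P = subst (m ≤_) #codes (injection-length codes code (λ i → proj₁ (proj₂ (coded i))) code-injective)
    where
    open WindowCodes
    #codes : length codes ≡ suc (K + P)
    #codes = cong suc (trans (length-++ (map (λ g → (g , 0)) G)) (cong (_+ P) (length-map _ G)))

  -- (C) Weights.  A small pair (u, v) has t(u) + t(v) + m ≥ c + 1; the
  -- total weight W of the pairs is Σ_{x∈G} t(x)·deg(x), where deg(x)
  -- counts the pairs containing x (a pair (x, x) twice).  deg(x) ≤ ν,
  -- with strict inequality when x + y ≥ c + m for some y ∈ G.

  below-c : ∀ {u v} → u + v < c + m → m < v → u < c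
  below-c {u} {v} lt m<v = +-cancelʳ-< m u c (<-trans (+-monoʳ-< u m<v) lt)

  pair-gap-bound : ∀ {u v} → u + v < c + m → m < u → m < v → c + 1 ≤ gap u + gap v + m
  pair-gap-bound {u} {v} lt m<u m<v = +-cancelʳ-≤ (u + v) (c + 1) (gap u + gap v + m) (begin
      c + 1 + (u + v)                     ≡⟨ eq₁ c u v ⟩
      c + suc (u + v)                     ≤⟨ +-monoʳ-≤ c lt ⟩
      c + (c + m)                         ≡⟨ eq₂ c m ⟩
      c + c + m                           ≡⟨ sym (cong₂ (λ a b → a + b + m) (m∸n+n≡m (<⇒≤ u<c)) (m∸n+n≡m (<⇒≤ v<c))) ⟩
      (gap u + u) + (gap v + v) + m       ≡⟨ sym (eq₃ (gap u) (gap v) m u v) ⟩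
      gap u + gap v + m + (u + v)         ∎)
    where
    open ≤-Reasoning
    u<c : u < c
    u<c = below-c lt m<v
    v<c : v < c
    v<c = below-c (subst (_< c + m) (+-comm u v) lt) m<u
    eq₁ : ∀ c u v → c + 1 + (u + v) ≡ c + suc (u + v)
    eq₁ = solve-∀
    eq₂ : ∀ c m → c + (c + m) ≡ c + c + m
    eq₂ = solve-∀
    eq₃ : ∀ a b k u v → (a + b + k) + (u + v) ≡ (a + u) + (b + v) + k
    eq₃ = solve-∀

  pairWeight : ℕ
  pairWeight = sumL pairs (λ p → gap (proj₁ p) + gap (proj₂ p))

  pairWeight-lower : P * (c + 1) ≤ pairWeight + P * m
  pairWeight-lower = begin
      P * (c + 1)                                          ≤⟨ sumL-lower pairs (c + 1) _ pair-bound ⟩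
      sumL pairs (λ p → gap (proj₁ p) + gap (proj₂ p) + m) ≡⟨ sumL-+ pairs _ (λ _ → m) ⟩
      pairWeight + sumL pairs (λ _ → m)                    ≡⟨ cong (pairWeight +_) (sumL-const pairs m) ⟩
      pairWeight + P * m                                   ∎
    where
    open ≤-Reasoning
    pair-bound : ∀ p → p ∈ pairs → c + 1 ≤ gap (proj₁ p) + gap (proj₂ p) + m
    pair-bound (u , v) p∈ with pairs⁻ p∈
    ... | u∈ , v∈ , _ , lt = pair-gap-bound lt (m<gen u∈) (m<gen v∈)

  ind : Bool → ℕ
  ind true = 1
  ind false = 0

  degree : ℕ → ℕ
  degree x = sumL G (λ y → ind (smallPair x y) + ind (smallPair y x))

  pairWeight≡Σdegree : pairWeight ≡ sumL G (λ x → gap x * degree x)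
  pairWeight≡Σdegree = begin
      pairWeight
        ≡⟨ sumL-concatMap G (λ x → map (x ,_) (filterᵇ (smallPair x) G)) (λ p → gap (proj₁ p) + gap (proj₂ p)) ⟩
      sumL G (λ x → sumL (map (x ,_) (filterᵇ (smallPair x) G)) (λ p → gap (proj₁ p) + gap (proj₂ p)))
        ≡⟨ sumL-cong G (λ x _ → sumL-map (filterᵇ (smallPair x) G) (x ,_) (λ p → gap (proj₁ p) + gap (proj₂ p))) ⟩
      sumL G (λ x → sumL (filterᵇ (smallPair x) G) (λ y → gap x + gap y))
        ≡⟨ sumL-cong G (λ x _ → sumL-filter G (smallPair x) (λ y → gap x + gap y)) ⟩
      sumL G (λ x → sumL G (λ y → if smallPair x y then gap x + gap y else 0))
        ≡⟨ sumL-cong G (λ x _ → sumL-cong G (λ y _ → if-as-ind (smallPair x y) (gap x) (gap y))) ⟩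
      sumL G (λ x → sumL G (λ y → ind (smallPair x y) * gap x + ind (smallPair x y) * gap y))
        ≡⟨ sumL-symmetrize G (λ x y → ind (smallPair x y)) gap ⟩
      sumL G (λ x → gap x * degree x) ∎
    where
    open ≡-Reasoning
    if-as-ind : ∀ b a d → (if b then a + d else 0) ≡ ind b * a + ind b * d
    if-as-ind true a d = cong₂ _+_ (sym (+-identityʳ a)) (sym (+-identityʳ d))
    if-as-ind false a d = refl

  -- orient x y = number of orders (x ≤ y, y ≤ x) that hold: 2 if x = y, else 1.
  orient : ℕ → ℕ → ℕ
  orient x y = ind (x ≤ᵇ y) + ind (y ≤ᵇ x)

  ind≤1 : ∀ b → ind b ≤ 1
  ind≤1 true = ≤-refl
  ind≤1 false = z≤n

  ind-∧ : ∀ a b → ind (a ∧ b) ≤ ind a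
  ind-∧ true b = ind≤1 b
  ind-∧ false b = z≤n

  ind-T : ∀ {b} → T b → ind b ≡ 1
  ind-T {true} _ = refl

  degree-term≤orient : ∀ x y → ind (smallPair x y) + ind (smallPair y x) ≤ orient x y
  degree-term≤orient x y = +-mono-≤ (ind-∧ (x ≤ᵇ y) _) (ind-∧ (y ≤ᵇ x) _)

  orient-positive : ∀ x y → 1 ≤ orient x y
  orient-positive x y with ≤-total x y
  ... | inj₁ x≤y = ≤-trans (≤-reflexive (sym (ind-T (≤⇒≤ᵇ x≤y)))) (m≤m+n _ _)
  ... | inj₂ y≤x = ≤-trans (≤-reflexive (sym (ind-T (≤⇒≤ᵇ y≤x)))) (m≤n+m _ _)

  orient-distinct : ∀ x y → x ≢ y → orient x y ≤ 1
  orient-distinct x y x≢y with x ≤ᵇ y in e₁ | y ≤ᵇ x in e₂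
  ... | true | true = ⊥-elim (x≢y (≤-antisym (≤ᵇ⇒≤ x y (subst T (sym e₁) tt)) (≤ᵇ⇒≤ y x (subst T (sym e₂) tt))))
  ... | true | false = ≤-refl
  ... | false | true = ≤-refl
  ... | false | false = z≤n

  orient-sum-absent : ∀ x ys → ¬ (x ∈ ys) → sumL ys (orient x) ≤ length ys
  orient-sum-absent x [] _ = z≤n
  orient-sum-absent x (y ∷ ys) x∉ = +-mono-≤ (orient-distinct x y (λ eq → x∉ (here eq))) (orient-sum-absent x ys (λ i → x∉ (there i)))

  orient-sum : ∀ x ys → x ∈ ys → Unique ys → sumL ys (orient x) ≤ suc (length ys)
  orient-sum x (y ∷ ys) (here refl) (x∉ ∷ _) =
    +-mono-≤ (+-mono-≤ (ind≤1 (x ≤ᵇ x)) (ind≤1 (x ≤ᵇ x))) (orient-sum-absent x ys (λ i → All.lookup x∉ i refl))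
  orient-sum x (y ∷ ys) (there x∈) (y∉ ∷ u) =
    +-mono-≤ (orient-distinct x y (λ eq → All.lookup y∉ x∈ (sym eq))) (orient-sum x ys x∈ u)

  degree≤ν : ∀ {x} → x ∈ G → degree x ≤ suc K
  degree≤ν {x} x∈ = ≤-trans (sumL-mono G (λ y _ → degree-term≤orient x y)) (orient-sum x G x∈ G-unique)

  -- If x + y ≥ c + m for some y ∈ G, neither (x, y) nor (y, x) is small.
  degree<ν : ∀ {x y} → x ∈ G → y ∈ G → ¬ (x + y < c + m) → degree x + 1 ≤ suc K
  degree<ν {x} {y} x∈ y∈ x+y≮ =
    ≤-trans (sumL-mono-slack G 1 y y∈ (λ z _ → degree-term≤orient x z) slack) (orient-sum x G x∈ G-unique)
    where
    not-small : ∀ a b → ¬ (a + b < c + m) → ind (smallPair a b) ≡ 0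
    not-small a b a+b≮ with a + b <ᵇ c + m in eq
    ... | true = ⊥-elim (a+b≮ (<ᵇ⇒< (a + b) (c + m) (subst T (sym eq) tt)))
    ... | false with a ≤ᵇ b
    ...   | true = refl
    ...   | false = refl
    slack : ind (smallPair x y) + ind (smallPair y x) + 1 ≤ orient x y
    slack = subst (λ z → z + 1 ≤ orient x y)
                  (sym (cong₂ _+_ (not-small x y x+y≮) (not-small y x (λ lt → x+y≮ (subst (_< c + m) (+-comm y x) lt)))))
                  (orient-positive x y)

  -- A vertex of degree < ν leaves its gap unused in Σ_x t(x)·ν.
  pairWeight+gap≤ : ∀ {z} → z ∈ G → degree z + 1 ≤ suc K → pairWeight + gap z ≤ deficit * suc K
  pairWeight+gap≤ {z} z∈ deg< = begin
      pairWeight + gap z                       ≡⟨ cong (_+ gap z) pairWeight≡Σdegree ⟩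
      sumL G (λ x → gap x * degree x) + gap z  ≤⟨ sumL-mono-slack G (gap z) z z∈ (λ x x∈ → *-monoʳ-≤ (gap x) (degree≤ν x∈)) slack ⟩
      sumL G (λ x → gap x * suc K)             ≡⟨ sumL-*ʳ G (suc K) gap ⟩
      deficit * suc K                          ∎
    where
    open ≤-Reasoning
    slack : gap z * degree z + gap z ≤ gap z * suc K
    slack = subst (_≤ gap z * suc K) (trans (*-distribˡ-+ (gap z) (degree z) 1) (cong (gap z * degree z +_) (*-identityʳ (gap z))))
                  (*-monoʳ-≤ (gap z) deg<)

  gap-lower : ∀ {z y} → y ∈ G → z + y < c + m → c + 3 ≤ 3 * gap z + 2 * m
  gap-lower {z} {y} y∈ lt = +-cancelʳ-≤ (3 * z) (c + 3) (3 * gap z + 2 * m) (begin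
      c + 3 + 3 * z                ≤⟨ <⇒≤ (+-cancelʳ-< (c + m) (c + 3 + 3 * z) (3 * c + 2 * m) chain) ⟩
      3 * c + 2 * m                ≡⟨ cong (λ w → 3 * w + 2 * m) (sym (m∸n+n≡m (<⇒≤ z<c))) ⟩
      3 * (gap z + z) + 2 * m      ≡⟨ eq₃ (gap z) z m ⟩
      3 * gap z + 2 * m + 3 * z    ∎)
    where
    open ≤-Reasoning
    eq₁ : ∀ c z y → c + 3 + 3 * z + 3 * y ≡ c + 3 * (z + y + 1)
    eq₁ = solve-∀
    eq₂ : ∀ c m → c + 3 * (c + m) ≡ 3 * c + 2 * m + (c + m)
    eq₂ = solve-∀
    eq₃ : ∀ a z m → 3 * (a + z) + 2 * m ≡ 3 * a + 2 * m + 3 * z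
    eq₃ = solve-∀
    z<c : z < c
    z<c = below-c lt (m<gen y∈)
    c+m<3y : c + m < 3 * y
    c+m<3y = <-≤-trans c+m<3a₂ (*-monoʳ-≤ 3 (a₂≤ y∈))
    chain : c + 3 + 3 * z + (c + m) < 3 * c + 2 * m + (c + m)
    chain = begin-strict
      c + 3 + 3 * z + (c + m)      <⟨ +-monoʳ-< (c + 3 + 3 * z) c+m<3y ⟩
      c + 3 + 3 * z + 3 * y        ≡⟨ eq₁ c z y ⟩
      c + 3 * (z + y + 1)          ≤⟨ +-monoʳ-≤ c (*-monoʳ-≤ 3 (subst (_≤ c + m) (+-comm 1 (z + y)) lt)) ⟩
      c + 3 * (c + m)              ≡⟨ eq₂ c m ⟩
      3 * c + 2 * m + (c + m)      ∎

  -- If m ≤ ν it follows from (A) alone;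
  -- otherwise it reduces (wilf-from-excess) to the excess bound e·c ≤ ν·T
  -- for e = m − ν, which is derived from (B) and (C).
  module ExcessBound (h9 : 9 * m ≤ 4 * (suc K * suc K)) (hB : conductorBound (suc K) ≤ c) (ν<m : suc K < m) where

    ν : ℕ
    ν = suc K

    e : ℕ
    e = m ∸ ν

    m≡ν+e : m ≡ ν + e
    m≡ν+e = sym (m+[n∸m]≡n (<⇒≤ ν<m))

    e≤P : e ≤ P
    e≤P = m≤n+o⇒m∸n≤o m ν m≤ν+P

    open LargeConductor ν m c h9 hB

    excess-all-diagonal-small : All (λ x → x + x < c + m) G → e * c ≤ ν * deficit
    excess-all-diagonal-small all-small =
      excess-bound-diagonal K m c deficit e diagonal-bound
        (excess-quadratic K e (subst (λ x → 9 * x ≤ _) m≡ν+e h9)) (ν[ν-1]m≤c K refl)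
      where
      open ≤-Reasoning
      diagonal-bound : K * (c + 1) ≤ 2 * deficit + K * m
      diagonal-bound = begin
        K * (c + 1)                                  ≤⟨ sumL-lower G (c + 1) (λ x → gap x + gap x + m)
                                                          (λ x x∈ → pair-gap-bound (All.lookup all-small x∈) (m<gen x∈) (m<gen x∈)) ⟩
        sumL G (λ x → gap x + gap x + m)             ≡⟨ sumL-+ G (λ x → gap x + gap x) (λ _ → m) ⟩
        sumL G (λ x → gap x + gap x) + sumL G (λ _ → m) ≡⟨ cong₂ _+_ (sumL-+ G gap gap) (sumL-const G m) ⟩
        deficit + deficit + K * m                    ≡⟨ cong (_+ K * m) (sym (cong (deficit +_) (+-identityʳ deficit))) ⟩
        2 * deficit + K * m                          ∎

    excess-via-vertex : ∀ {z y} → z ∈ G → y ∈ G → z + y < c + m → degree z + 1 ≤ ν → e * c ≤ ν * deficit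
    excess-via-vertex {z} z∈ y∈ lt deg< =
      excess-bound-pairs ν m c deficit P pairWeight (gap z) e pairWeight-lower (pairWeight+gap≤ z∈ deg<)
        (gap-lower y∈ lt) e≤P m≤c+1 (3em+2m≤c e (m∸n≤m m ν))

    -- Some diagonal pair (z, z) is not small, so deg z < ν; since e ≥ 1 there
    -- is a small pair (a, b), and either z or a is a vertex as above.
    excess-large-diagonal : ∀ {z} → z ∈ G → ¬ (z + z < c + m) → e * c ≤ ν * deficit
    excess-large-diagonal {z} z∈ z+z≮ with nonempty-member pairs (≤-trans (m<n⇒0<n∸m ν<m) e≤P)
    ... | (a , b) , ab∈ with pairs⁻ ab∈
    ... | a∈ , b∈ , _ , a+b< with a + z <? c + m
    ...   | yes a+z< = excess-via-vertex z∈ a∈ (subst (_< c + m) (+-comm a z) a+z<) (degree<ν z∈ z∈ z+z≮)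
    ...   | no a+z≮ = excess-via-vertex a∈ b∈ a+b< (degree<ν a∈ z∈ a+z≮)

    excess-bound : e * c ≤ ν * deficit
    excess-bound with all? (λ x → x + x <? c + m) G
    ... | yes all-small = excess-all-diagonal-small all-small
    ... | no not-all with find (¬All⇒Any¬ (λ x → x + x <? c + m) G not-all)
    ...   | z , z∈ , z+z≮ = excess-large-diagonal z∈ z+z≮

  wilf-large-conductor : 9 * m ≤ 4 * (suc K * suc K) → conductorBound (suc K) ≤ c → c ≤ suc K * sizeL S c
  wilf-large-conductor h9 hB with m ≤? suc K
  ... | yes m≤ν = ≤-trans (m≤m+n c deficit) (≤-trans L-lower-bound (*-monoˡ-≤ (sizeL S c) m≤ν))
  ... | no m≰ν = wilf-from-excess ν m c deficit (sizeL S c) e m≡ν+e L-lower-bound excess-bound {{>-nonZero 0<m}}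
    where open ExcessBound h9 hB (≰⇒> m≰ν)

-- Finiteness: a subset of ℕ that contains everything from B on is
-- determined by its Boolean prefix of length B, one of 2^B lists.
module Prefixes where

  prefix : Subset → ℕ → List Bool
  prefix S zero = []
  prefix S (suc n) = S 0 ∷ prefix (λ x → S (suc x)) n

  fromPrefix : List Bool → Subset
  fromPrefix [] x = true
  fromPrefix (b ∷ bs) zero = b
  fromPrefix (b ∷ bs) (suc x) = fromPrefix bs x

  boolLists : ℕ → List (List Bool)
  boolLists zero = [] ∷ []
  boolLists (suc n) = concatMap (λ bs → (true ∷ bs) ∷ (false ∷ bs) ∷ []) (boolLists n)

  prefix∈boolLists : ∀ n S → prefix S n ∈ boolLists n
  prefix∈boolLists zero S = here refl
  prefix∈boolLists (suc n) S = ∈-concatMap⁺ (λ bs → (true ∷ bs) ∷ (false ∷ bs) ∷ []) {xs = boolLists n}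
    (Any.map (λ { refl → cons∈ (S 0) }) (prefix∈boolLists n (λ x → S (suc x))))
    where
    bs = prefix (λ x → S (suc x)) n
    cons∈ : ∀ b → (b ∷ bs) ∈ ((true ∷ bs) ∷ (false ∷ bs) ∷ [])
    cons∈ true = here refl
    cons∈ false = there (here refl)

  fromPrefix-below : ∀ n S x → x < n → fromPrefix (prefix S n) x ≡ S x
  fromPrefix-below (suc n) S zero _ = refl
  fromPrefix-below (suc n) S (suc x) (s≤s x<n) = fromPrefix-below n (λ y → S (suc y)) x x<n

  fromPrefix-above : ∀ n S x → n ≤ x → fromPrefix (prefix S n) x ≡ true
  fromPrefix-above zero S x _ = refl
  fromPrefix-above (suc n) S (suc x) (s≤s n≤x) = fromPrefix-above n (λ y → S (suc y)) x n≤x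

  determined-by-prefix : ∀ B S → (∀ x → B ≤ x → x ∈S S) →
                         Any (λ (T : Subset) → ∀ x → S x ≡ T x) (map fromPrefix (boolLists B))
  determined-by-prefix B S above = map⁺ (Any.map (λ { refl → agree }) (prefix∈boolLists B S))
    where
    agree : ∀ x → S x ≡ fromPrefix (prefix S B) x
    agree x with x <? B
    ... | yes x<B = sym (fromPrefix-below B S x x<B)
    ... | no x≮B = trans (above x (≮⇒≥ x≮B)) (sym (fromPrefix-above B S x (≮⇒≥ x≮B)))

open Prefixes

first-generator≡multiplicity : ∀ S a₁ a₂ rest m → IsMinimalGenerators S (a₁ ∷ a₂ ∷ rest) →
                               IsMultiplicity S m → a₁ ≡ m
first-generator≡multiplicity S a₁ a₂ rest m mg (0<m , m∈S , m-least) = ≤-antisym a₁≤m (m-least a₁ 0<a₁ a₁∈S)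
  where
  gens = a₁ ∷ a₂ ∷ rest
  a₁∈S : a₁ ∈S S
  a₁∈S = proj₁ (proj₂ (proj₂ mg)) a₁ (subst (Rep gens) (+-identityʳ a₁) (repStep (here refl) rep0))
  -- 0 is not a minimal generator, since it is the empty sum
  0<a₁ : 0 < a₁
  0<a₁ = n≢0⇒n>0 (λ { refl → proj₂ (proj₂ (proj₂ mg)) 0 (here refl) rep0 })
  a₁≤gen : ∀ {g} → g ∈ gens → a₁ ≤ g
  a₁≤gen (here refl) = ≤-refl
  a₁≤gen (there g∈) with proj₁ mg
  ... | a₁<a₂ ∷ l = <⇒≤ (All.lookup (Linked⇒All <-trans a₁<a₂ l) g∈)
  -- m ≠ 0 is a nonempty sum of generators, each at least a₁
  a₁≤m : a₁ ≤ m
  a₁≤m with proj₁ (proj₂ mg) m m∈S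
  ... | rep0 = ⊥-elim (<-irrefl refl 0<m)
  ... | repStep {x} {g} g∈ _ = ≤-trans (a₁≤gen g∈) (m≤m+n g x)

wilf-violator-small-conductor : ∀ ν S → IsNumericalSemigroup S → ∀ a₁ a₂ rest c m →
  IsMinimalGenerators S (a₁ ∷ a₂ ∷ rest) → IsConductor S c → IsMultiplicity S m →
  length (a₁ ∷ a₂ ∷ rest) ≡ ν → c + m < 3 * a₂ → 9 * m ≤ 4 * (ν * ν) → ν * sizeL S c < c →
  c < conductorBound ν
wilf-violator-small-conductor ν S ns a₁ a₂ rest c m mg cond mult refl c+m<3a₂ h9 not-wilf
  with conductorBound ν ≤? c
... | no B≰c = ≰⇒> B≰c
... | yes B≤c = ⊥-elim (<⇒≱ not-wilf (WilfArgument.wilf-large-conductor S ns m a₂ rest c mg' cond (proj₁ mult) c+m<3a₂ h9 B≤c))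
  where
  mg' : IsMinimalGenerators S (m ∷ a₂ ∷ rest)
  mg' = subst (λ a → IsMinimalGenerators S (a ∷ a₂ ∷ rest)) (first-generator≡multiplicity S a₁ a₂ rest m mg mult) mg

-- Every Wilf violator of embedding dimension ν agrees with one of the
-- 2^B(ν) subsets fromPrefix bs, so one may take N = 0.
proposition4p8 : ∃[ N ] ∀ (ν : ℕ) → N ≤ ν →
    ∃[ Ss ] (∀ (S : Subset) → IsNumericalSemigroup S →
      ∀ (a₁ a₂ : ℕ) (rest : List ℕ) (c m : ℕ) →
      IsMinimalGenerators S (a₁ ∷ a₂ ∷ rest) →
      IsConductor S c → IsMultiplicity S m →
      length (a₁ ∷ a₂ ∷ rest) ≡ ν →
      c + m < 3 * a₂ →
      9 * m ≤ 4 * (ν * ν) →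
      ν * sizeL S c < c →
      Any (λ (T : Subset) → ∀ x → S x ≡ T x) Ss)
proposition4p8 = 0 , λ ν _ → map fromPrefix (boolLists (conductorBound ν)) ,
  λ S ns a₁ a₂ rest c m mg cond mult len c+m<3a₂ h9 not-wilf →
    let c<B = wilf-violator-small-conductor ν S ns a₁ a₂ rest c m mg cond mult len c+m<3a₂ h9 not-wilf
    in determined-by-prefix (conductorBound ν) S (λ x B≤x → proj₁ cond x (≤-trans (<⇒≤ c<B) B≤x))
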